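{- Let $S$ be a random subset of a finite set $V$ and let $u\in V$. Suppose that all events $\{u'\in S\}$ for $u'\ne u$ are jointly independent of the event $\{u\in S\}$. Let $s$ be an element of $S$ chosen uniformly at random (if $S=\varnothing$, $s$ is undefined). Then $\Pr[u=s]\ge \Pr[u\in S]/(\mathbb{E}[|S|]+1)$.
   Formalization: The probabilities of the random subset S are rational. -}

module Defs where

open import Data.Nat using (ℕ; zero; suc)
open import Data.Fin using (Fin)
open import Data.Fin.Subset using (Subset; Side; inside; outside; ∣_∣)
open import Data.Vec using (Vec; []; _∷_; lookup)
open import Data.List using (List; []; _∷_; map; _++_; foldr)
open import Data.Integer using (+_)
open import Data.Rational using (ℚ; 0ℚ; 1ℚ; _+_; _*_; _≤_; _÷_; _/_; ≢-nonZero)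
open import Data.Rational.Properties using (_≟_)
open import Relation.Nullary using (yes; no)
open import Relation.Binary.PropositionalEquality using (_≡_; _≢_)

allSubsets : ∀ n → List (Subset n)
allSubsets zero    = [] ∷ []
allSubsets (suc n) = map (inside ∷_) (allSubsets n) ++ map (outside ∷_) (allSubsets n)

ΣS : ∀ {n} → (Subset n → ℚ) → ℚ
ΣS {n} f = foldr (λ S acc → f S + acc) 0ℚ (allSubsets n)

ind : Side → ℚ
ind inside  = 1ℚ
ind outside = 0ℚ

record Distribution (n : ℕ) : Set where
  field
    P       : Subset n → ℚ
    nonneg  : ∀ S → 0ℚ ≤ P S
    total   : ΣS P ≡ 1ℚ
open Distribution public

Event : ℕ → Set
Event n = Subset n → Side

Pr : ∀ {n} → Distribution n → Event n → ℚ
Pr D E = ΣS (λ S → P D S * ind (E S))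

memEvent : ∀ {n} → Fin n → Event n
memEvent u S = lookup S u

_∩_ : ∀ {n} → Event n → Event n → Event n
(E ∩ F) S with E S
... | inside  = F S
... | outside = outside

AgreeOff : ∀ {n} → Fin n → Subset n → Subset n → Set
AgreeOff u S S' = ∀ v → v ≢ u → lookup S v ≡ lookup S' v

-- E lies in the σ-algebra generated by the events {u' ∈ S}, u' ≠ u
-- (i.e. E is determined by the memberships of elements other than u).
GeneratedOff : ∀ {n} → Fin n → Event n → Set
GeneratedOff u E = ∀ S S' → AgreeOff u S S' → E S ≡ E S'

-- The events {u' ∈ S} (u' ≠ u) are jointly independent of {u ∈ S}:
-- every event in the σ-algebra they generate is independent of {u ∈ S}.
JointlyIndepOf : ∀ {n} → Distribution n → Fin n → Set
JointlyIndepOf {n} D u =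
  (E : Event n) → GeneratedOff u E →
  Pr D (E ∩ memEvent u) ≡ Pr D E * Pr D (memEvent u)

-- 1/k for k ≥ 1 (value at 0 irrelevant: it is only used when k ≥ 1).
inv : ℕ → ℚ
inv zero    = 0ℚ
inv (suc k) = + 1 / suc k

-- Pr[u = s], s uniform in S (undefined, hence u ≠ s, when S = ∅).
PrEqUniform : ∀ {n} → Distribution n → Fin n → ℚ
PrEqUniform D u = ΣS (λ S → P D S * (ind (lookup S u) * inv ∣ S ∣))

ExpSize : ∀ {n} → Distribution n → ℚ
ExpSize D = ΣS (λ S → P D S * (+ ∣ S ∣ / 1))

-- Division with the convention p / 0 = 0 (only used with positive denominators).
_÷'_ : ℚ → ℚ → ℚ
p ÷' q with q ≟ 0ℚ
... | yes _  = 0ℚ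
... | no q≢0 = _÷_ p q {{≢-nonZero q≢0}}

{-# OPTIONS --safe #-}
module Submission where

-- Put b = 𝔼|S| + 1, c = 1/b and p = Pr[u ∈ S].  By convexity of x ↦ 1/x, its tangent
-- at x = b lies below it: 1/k ≥ 2c − c²k for all k ≥ 1.  Hence
--   Pr[u = s] = 𝔼[1{u ∈ S}/|S|] ≥ 2cp − c² 𝔼[1{u ∈ S} |S|].
-- Expanding |S| as a sum of indicators and using independence,
--   𝔼[1{u ∈ S} |S|] = p + p Σ_{v ≠ u} Pr[v ∈ S] ≤ p (𝔼|S| + 1) = pb,
-- so Pr[u = s] ≥ 2cp − c²pb = cp = p/b.

open import Defs
open import Data.Nat using (ℕ; zero; suc)
open import Data.Fin using (Fin; zero; suc; punchIn)
open import Data.Fin.Properties using (punchInᵢ≢i)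
open import Data.Fin.Subset using (Subset; inside; outside; ∣_∣)
open import Data.Vec using ([]; _∷_)
open import Data.List using (List; []; _∷_; foldr; length)
import Data.List as List
open import Data.Sum using (inj₁; inj₂)
open import Data.Integer using (+_)
import Data.Integer as ℤ
import Data.Integer.Properties as ℤ
open import Data.Rational
  using (ℚ; 0ℚ; 1ℚ; _+_; _*_; _-_; -_; _/_; 1/_; _≤_; NonZero; fromℚᵘ;
         ≢-nonZero; nonNegative; nonPositive)
open import Data.Rational.Properties
import Data.Rational.Unnormalised as ℚᵘ
import Data.Rational.Unnormalised.Properties as ℚᵘ
open import Data.Rational.Solver using (module +-*-Solver)
open import Algebra.Bundles using (module Ring)
open import Algebra.Properties.Semiring.Sum (Ring.semiring +-*-ring)
  using (sum; sum-syntax; sum-cong-≗; sum-replicate-zero; sum-remove; ∑-distrib-+; ∑-comm;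
         *-distribˡ-sum; *-distribʳ-sum)
open import Relation.Nullary using (yes; no; contradiction)
open import Relation.Binary.PropositionalEquality
  using (_≡_; _≢_; refl; sym; trans; cong; cong₂; module ≡-Reasoning)

open +-*-Solver using (solve; _:=_; _:+_; _:*_; _:-_; :-_; con)

0≤* : ∀ {p q} → 0ℚ ≤ p → 0ℚ ≤ q → 0ℚ ≤ p * q
0≤* {p} {q} 0≤p 0≤q =
  nonNegative⁻¹ (p * q) {{nonNeg*nonNeg⇒nonNeg p {{nonNegative 0≤p}} q {{nonNegative 0≤q}}}}

0≤p*p : ∀ p → 0ℚ ≤ p * p
0≤p*p p with ≤-total 0ℚ p
... | inj₁ 0≤p = 0≤* 0≤p 0≤p
... | inj₂ p≤0 =
  nonNegative⁻¹ (p * p) {{nonPos*nonPos⇒nonPos p {{nonPositive p≤0}} p {{nonPositive p≤0}}}}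

p≤p+q : ∀ {p q} → 0ℚ ≤ q → p ≤ p + q
p≤p+q {p} 0≤q = ≤-trans (≤-reflexive (sym (+-identityʳ p))) (+-monoʳ-≤ p 0≤q)

-- The normalised fractions  + n / 1  do not compute for a variable n (normalisation goes
-- through gcd), so identities between them are transported from unnormalised fractions.
fromℚᵘ-homo-+ : ∀ p q → fromℚᵘ (p ℚᵘ.+ q) ≡ fromℚᵘ p + fromℚᵘ q
fromℚᵘ-homo-+ p q = toℚᵘ-injective (ℚᵘ.≃-trans (toℚᵘ-fromℚᵘ (p ℚᵘ.+ q)) (ℚᵘ.≃-sym
  (ℚᵘ.≃-trans (toℚᵘ-homo-+ (fromℚᵘ p) (fromℚᵘ q))
              (ℚᵘ.+-cong (toℚᵘ-fromℚᵘ p) (toℚᵘ-fromℚᵘ q)))))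

fromℚᵘ-homo-* : ∀ p q → fromℚᵘ (p ℚᵘ.* q) ≡ fromℚᵘ p * fromℚᵘ q
fromℚᵘ-homo-* p q = toℚᵘ-injective (ℚᵘ.≃-trans (toℚᵘ-fromℚᵘ (p ℚᵘ.* q)) (ℚᵘ.≃-sym
  (ℚᵘ.≃-trans (toℚᵘ-homo-* (fromℚᵘ p) (fromℚᵘ q))
              (ℚᵘ.*-cong (toℚᵘ-fromℚᵘ p) (toℚᵘ-fromℚᵘ q)))))

[1+n]/1≡1+n/1 : ∀ n → + suc n / 1 ≡ 1ℚ + + n / 1
[1+n]/1≡1+n/1 n =
  trans (fromℚᵘ-cong {ℚᵘ.mkℚᵘ (+ suc n) 0} {ℚᵘ.1ℚᵘ ℚᵘ.+ ℚᵘ.mkℚᵘ (+ n) 0} (ℚᵘ.*≡* cross))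
        (fromℚᵘ-homo-+ ℚᵘ.1ℚᵘ (ℚᵘ.mkℚᵘ (+ n) 0))
  where
  cross : + suc n ℤ.* + 1 ≡ (+ 1 ℤ.* + 1 ℤ.+ + n ℤ.* + 1) ℤ.* + 1
  cross = cong (λ m → (+ 1 ℤ.+ m) ℤ.* + 1) (sym (ℤ.*-identityʳ (+ n)))

[1+n]/1*1/[1+n]≡1 : ∀ n → + suc n / 1 * (+ 1 / suc n) ≡ 1ℚ
[1+n]/1*1/[1+n]≡1 n =
  trans (sym (fromℚᵘ-homo-* (ℚᵘ.mkℚᵘ (+ suc n) 0) (ℚᵘ.mkℚᵘ (+ 1) n)))
        (fromℚᵘ-cong (ℚᵘ.*-inverseʳ (ℚᵘ.mkℚᵘ (+ suc n) 0)))

-- The tangent to x ↦ 1/x at x = 1/c.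
tangent : ℚ → ℚ → ℚ
tangent c x = c + c - c * c * x

tangent≤reciprocal : ∀ c {x q} → 0ℚ ≤ x → x * q ≡ 1ℚ → tangent c x ≤ q
tangent≤reciprocal c {x} {q} 0≤x xq≡1 = begin
  tangent c x                              ≤⟨ p≤p+q (0≤* 0≤x (0≤p*p (q - c))) ⟩
  tangent c x + x * ((q - c) * (q - c))    ≡⟨ completeSquare c x q ⟩
  q + (x * q - 1ℚ) * (q - (c + c))         ≡⟨ cong (λ y → q + (y - 1ℚ) * (q - (c + c))) xq≡1 ⟩
  q + 0ℚ * (q - (c + c))                   ≡⟨ cong (λ y → q + y) (*-zeroˡ (q - (c + c))) ⟩
  q + 0ℚ                                   ≡⟨ +-identityʳ q ⟩
  q                                        ∎
  where
  open ≤-Reasoning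
  completeSquare : ∀ c x q → tangent c x + x * ((q - c) * (q - c))
                           ≡ q + (x * q - 1ℚ) * (q - (c + c))
  completeSquare = solve 3 (λ c x q → (c :+ c :- c :* c :* x) :+ x :* ((q :- c) :* (q :- c))
                                     := q :+ (x :* q :- con 1ℚ) :* (q :- (c :+ c))) refl

tangent-at-inverse : ∀ {c b} → c * b ≡ 1ℚ → tangent c b ≡ c
tangent-at-inverse {c} {b} cb≡1 = begin
  tangent c b              ≡⟨ factor c b ⟩
  c + c * (1ℚ - c * b)     ≡⟨ cong (λ x → c + c * (1ℚ - x)) cb≡1 ⟩
  c + c * 0ℚ               ≡⟨ cong (λ x → c + x) (*-zeroʳ c) ⟩
  c + 0ℚ                   ≡⟨ +-identityʳ c ⟩
  c                        ∎
  where
  open ≡-Reasoning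
  factor : ∀ c b → tangent c b ≡ c + c * (1ℚ - c * b)
  factor = solve 2 (λ c b → c :+ c :- c :* c :* b := c :+ c :* (con 1ℚ :- c :* b)) refl

0≤ind : ∀ s → 0ℚ ≤ ind s
0≤ind inside  = nonNegative⁻¹ 1ℚ
0≤ind outside = ≤-refl

0≤inv : ∀ m → 0ℚ ≤ inv m
0≤inv zero    = ≤-refl
0≤inv (suc m) = nonNegative⁻¹ (inv (suc m)) {{normalize-nonNeg 1 (suc m)}}

ind-∩ : ∀ {n} (E F : Event n) S → ind ((E ∩ F) S) ≡ ind (E S) * ind (F S)
ind-∩ E F S with E S
... | inside  = sym (*-identityˡ (ind (F S)))
... | outside = sym (*-zeroˡ (ind (F S)))

ind*ind≡ind : ∀ s → ind s * ind s ≡ ind s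
ind*ind≡ind inside  = refl
ind*ind≡ind outside = refl

size : ∀ {n} → Subset n → ℚ
size S = + ∣ S ∣ / 1

size≡∑ind : ∀ {n} (S : Subset n) → size S ≡ ∑[ v < n ] ind (memEvent v S)
size≡∑ind []            = refl
size≡∑ind (inside  ∷ S) = trans ([1+n]/1≡1+n/1 ∣ S ∣) (cong (λ x → 1ℚ + x) (size≡∑ind S))
size≡∑ind (outside ∷ S) = trans (size≡∑ind S) (sym (+-identityˡ _))

∈⇒∣S∣≢0 : ∀ {n} (S : Subset n) u → memEvent u S ≡ inside → ∣ S ∣ ≢ 0
∈⇒∣S∣≢0 (inside  ∷ S) u       _   ()
∈⇒∣S∣≢0 (outside ∷ S) (suc u) u∈S = ∈⇒∣S∣≢0 S u u∈S

ind*tangent≤ind*inv : ∀ c s m → (s ≡ inside → m ≢ 0) →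
                      ind s * tangent c (+ m / 1) ≤ ind s * inv m
ind*tangent≤ind*inv c outside m       _     =
  ≤-reflexive (trans (*-zeroˡ (tangent c (+ m / 1))) (sym (*-zeroˡ (inv m))))
ind*tangent≤ind*inv c inside  zero    ∈⇒m≢0 = contradiction refl (∈⇒m≢0 refl)
ind*tangent≤ind*inv c inside  (suc m) _     = *-monoˡ-≤-nonNeg 1ℚ
  (tangent≤reciprocal c (nonNegative⁻¹ _ {{normalize-nonNeg (suc m) 1}}) ([1+n]/1*1/[1+n]≡1 m))

foldr-+≡∑ : ∀ {A : Set} (f : A → ℚ) (xs : List A) →
            foldr (λ x acc → f x + acc) 0ℚ xs ≡ ∑[ i < length xs ] f (List.lookup xs i)
foldr-+≡∑ f []       = refl
foldr-+≡∑ f (x ∷ xs) = cong (λ y → f x + y) (foldr-+≡∑ f xs)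

sum-mono-≤ : ∀ {m} {f g : Fin m → ℚ} → (∀ i → f i ≤ g i) → sum f ≤ sum g
sum-mono-≤ {zero}  _   = ≤-refl
sum-mono-≤ {suc m} f≤g = +-mono-≤ (f≤g zero) (sum-mono-≤ (λ i → f≤g (suc i)))

𝔼 : ∀ {n} → Distribution n → (Subset n → ℚ) → ℚ
𝔼 D X = ΣS (λ S → P D S * X S)

module Expectation {n} (D : Distribution n) where

  private
    N : ℕ
    N = length (allSubsets n)

    outcome : Fin N → Subset n
    outcome = List.lookup (allSubsets n)

    weighted : (Subset n → ℚ) → Fin N → ℚ
    weighted X i = P D (outcome i) * X (outcome i)

    0≤P : ∀ i → 0ℚ ≤ P D (outcome i)
    0≤P i = nonneg D (outcome i)

  𝔼≡∑ : ∀ X → 𝔼 D X ≡ sum (weighted X)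
  𝔼≡∑ X = foldr-+≡∑ (λ S → P D S * X S) (allSubsets n)

  𝔼-cong : ∀ {X Y} → (∀ S → X S ≡ Y S) → 𝔼 D X ≡ 𝔼 D Y
  𝔼-cong {X} {Y} X≗Y = begin
    𝔼 D X              ≡⟨ 𝔼≡∑ X ⟩
    sum (weighted X)   ≡⟨ sum-cong-≗ (λ i → cong (P D (outcome i) *_) (X≗Y (outcome i))) ⟩
    sum (weighted Y)   ≡⟨ 𝔼≡∑ Y ⟨
    𝔼 D Y              ∎
    where open ≡-Reasoning

  𝔼-mono : ∀ {X Y} → (∀ S → X S ≤ Y S) → 𝔼 D X ≤ 𝔼 D Y
  𝔼-mono {X} {Y} X≤Y = begin
    𝔼 D X              ≡⟨ 𝔼≡∑ X ⟩
    sum (weighted X)   ≤⟨ sum-mono-≤ (λ i → *-monoˡ-≤-nonNeg (P D (outcome i)) {{nonNegative (0≤P i)}}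
                                                             (X≤Y (outcome i))) ⟩
    sum (weighted Y)   ≡⟨ 𝔼≡∑ Y ⟨
    𝔼 D Y              ∎
    where open ≤-Reasoning

  𝔼-nonNeg : ∀ {X} → (∀ S → 0ℚ ≤ X S) → 0ℚ ≤ 𝔼 D X
  𝔼-nonNeg {X} 0≤X = begin
    0ℚ                 ≡⟨ sum-replicate-zero N ⟨
    ∑[ _ < N ] 0ℚ      ≤⟨ sum-mono-≤ (λ i → 0≤* (0≤P i) (0≤X (outcome i))) ⟩
    sum (weighted X)   ≡⟨ 𝔼≡∑ X ⟨
    𝔼 D X              ∎
    where open ≤-Reasoning

  𝔼-linear : ∀ a b X Y → 𝔼 D (λ S → a * X S - b * Y S) ≡ a * 𝔼 D X - b * 𝔼 D Y
  𝔼-linear a b X Y = begin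
    𝔼 D (λ S → a * X S - b * Y S)
      ≡⟨ 𝔼≡∑ _ ⟩
    sum (λ i → P D (outcome i) * (a * X (outcome i) - b * Y (outcome i)))
      ≡⟨ sum-cong-≗ (λ i → distribute (P D (outcome i)) a b (X (outcome i)) (Y (outcome i))) ⟩
    sum (λ i → a * weighted X i + - b * weighted Y i)
      ≡⟨ ∑-distrib-+ (λ i → a * weighted X i) (λ i → - b * weighted Y i) ⟩
    sum (λ i → a * weighted X i) + sum (λ i → - b * weighted Y i)
      ≡⟨ cong₂ _+_ (*-distribˡ-sum a (weighted X)) (*-distribˡ-sum (- b) (weighted Y)) ⟨
    a * sum (weighted X) + - b * sum (weighted Y)
      ≡⟨ cong₂ (λ x y → a * x + - b * y) (𝔼≡∑ X) (𝔼≡∑ Y) ⟨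
    a * 𝔼 D X + - b * 𝔼 D Y
      ≡⟨ cong (λ y → a * 𝔼 D X + y) (neg-distribˡ-* b (𝔼 D Y)) ⟨
    a * 𝔼 D X - b * 𝔼 D Y
      ∎
    where
    open ≡-Reasoning
    distribute : ∀ p a b x y → p * (a * x - b * y) ≡ a * (p * x) + - b * (p * y)
    distribute = solve 5 (λ p a b x y → p :* (a :* x :- b :* y)
                                      := a :* (p :* x) :+ (:- b) :* (p :* y)) refl

  𝔼-∑ : ∀ {m} (X : Fin m → Subset n → ℚ) →
        𝔼 D (λ S → ∑[ v < m ] X v S) ≡ ∑[ v < m ] 𝔼 D (X v)
  𝔼-∑ {m} X = begin
    𝔼 D (λ S → ∑[ v < m ] X v S)
      ≡⟨ 𝔼≡∑ _ ⟩
    ∑[ i < N ] (P D (outcome i) * ∑[ v < m ] X v (outcome i))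
      ≡⟨ sum-cong-≗ (λ i → *-distribˡ-sum (P D (outcome i)) (λ v → X v (outcome i))) ⟩
    ∑[ i < N ] ∑[ v < m ] weighted (X v) i
      ≡⟨ ∑-comm (λ i v → weighted (X v) i) ⟩
    ∑[ v < m ] sum (weighted (X v))
      ≡⟨ sum-cong-≗ (λ v → 𝔼≡∑ (X v)) ⟨
    ∑[ v < m ] 𝔼 D (X v)
      ∎
    where open ≡-Reasoning

module _ {n} (D : Distribution n) where
  open Expectation D

  Pr[E∩E]≡Pr[E] : ∀ E → Pr D (E ∩ E) ≡ Pr D E
  Pr[E∩E]≡Pr[E] E = 𝔼-cong (λ S → trans (ind-∩ E E S) (ind*ind≡ind (E S)))

  Pr[v∩u]≡Pr[v]*Pr[u] : ∀ {u v} → JointlyIndepOf D u → v ≢ u →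
                        Pr D (memEvent v ∩ memEvent u) ≡ Pr D (memEvent v) * Pr D (memEvent u)
  Pr[v∩u]≡Pr[v]*Pr[u] {v = v} indep v≢u = indep (memEvent v) (λ S S′ S≈S′ → S≈S′ v v≢u)

  ExpSize≡∑Pr : ExpSize D ≡ ∑[ v < n ] Pr D (memEvent v)
  ExpSize≡∑Pr = trans (𝔼-cong size≡∑ind) (𝔼-∑ (λ v S → ind (memEvent v S)))

  𝔼[1ᵤ*size]≡∑Pr[v∩u] : ∀ u → 𝔼 D (λ S → ind (memEvent u S) * size S)
                            ≡ ∑[ v < n ] Pr D (memEvent v ∩ memEvent u)
  𝔼[1ᵤ*size]≡∑Pr[v∩u] u =
    trans (𝔼-cong 1ᵤ*size≡∑ind[v∩u]) (𝔼-∑ (λ v S → ind ((memEvent v ∩ memEvent u) S)))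
    where
    open ≡-Reasoning
    1ᵤ*size≡∑ind[v∩u] : ∀ S → ind (memEvent u S) * size S
                            ≡ ∑[ v < n ] ind ((memEvent v ∩ memEvent u) S)
    1ᵤ*size≡∑ind[v∩u] S = begin
      ind (memEvent u S) * size S
        ≡⟨ cong (ind (memEvent u S) *_) (size≡∑ind S) ⟩
      ind (memEvent u S) * ∑[ v < n ] ind (memEvent v S)
        ≡⟨ *-distribˡ-sum (ind (memEvent u S)) (λ v → ind (memEvent v S)) ⟩
      ∑[ v < n ] (ind (memEvent u S) * ind (memEvent v S))
        ≡⟨ sum-cong-≗ (λ v → sym (trans (ind-∩ (memEvent v) (memEvent u) S)
                                        (*-comm (ind (memEvent v S)) (ind (memEvent u S))))) ⟩
      ∑[ v < n ] ind ((memEvent v ∩ memEvent u) S)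
        ∎

module _ {n} (D : Distribution (suc n)) (u : Fin (suc n)) (indep : JointlyIndepOf D u) where
  open Expectation D

  private
    p : ℚ
    p = Pr D (memEvent u)

    others : ℚ
    others = ∑[ j < n ] Pr D (memEvent (punchIn u j))

  𝔼[1ᵤ*size]≤Pr[u]*[ExpSize+1] : 𝔼 D (λ S → ind (memEvent u S) * size S) ≤ p * (ExpSize D + 1ℚ)
  𝔼[1ᵤ*size]≤Pr[u]*[ExpSize+1] = begin
    𝔼 D (λ S → ind (memEvent u S) * size S)
      ≡⟨ 𝔼[1ᵤ*size]≡∑Pr[v∩u] D u ⟩
    ∑[ v < suc n ] Pr D (memEvent v ∩ memEvent u)
      ≡⟨ sum-remove {i = u} (λ v → Pr D (memEvent v ∩ memEvent u)) ⟩
    Pr D (memEvent u ∩ memEvent u) + ∑[ j < n ] Pr D (memEvent (punchIn u j) ∩ memEvent u)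
      ≡⟨ cong₂ _+_ (Pr[E∩E]≡Pr[E] D (memEvent u))
                   (sum-cong-≗ (λ j → Pr[v∩u]≡Pr[v]*Pr[u] D indep (punchInᵢ≢i u j))) ⟩
    p + ∑[ j < n ] (Pr D (memEvent (punchIn u j)) * p)
      ≡⟨ cong (λ x → p + x) (*-distribʳ-sum p (λ j → Pr D (memEvent (punchIn u j)))) ⟨
    p + others * p
      ≤⟨ p≤p+q (0≤p*p p) ⟩
    p + others * p + p * p
      ≡⟨ regroup p others ⟩
    p * ((p + others) + 1ℚ)
      ≡⟨ cong (λ e → p * (e + 1ℚ))
              (trans (ExpSize≡∑Pr D) (sum-remove {i = u} (λ v → Pr D (memEvent v)))) ⟨
    p * (ExpSize D + 1ℚ)
      ∎
    where
    open ≤-Reasoning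
    regroup : ∀ p r → p + r * p + p * p ≡ p * ((p + r) + 1ℚ)
    regroup = solve 2 (λ p r → p :+ r :* p :+ p :* p := p :* ((p :+ r) :+ con 1ℚ)) refl

  Pr[u]*1/[ExpSize+1]≤PrEqUniform : .{{_ : NonZero (ExpSize D + 1ℚ)}} →
                                     p * 1/ (ExpSize D + 1ℚ) ≤ PrEqUniform D u
  Pr[u]*1/[ExpSize+1]≤PrEqUniform = begin
    p * c
      ≡⟨ cong (p *_) (tangent-at-inverse (*-inverseˡ b)) ⟨
    p * tangent c b
      ≡⟨ expand p c b ⟩
    (c + c) * p - c * c * (p * b)
      ≤⟨ +-monoʳ-≤ ((c + c) * p) (neg-antimono-≤
           (*-monoˡ-≤-nonNeg (c * c) {{nonNegative (0≤p*p c)}} 𝔼[1ᵤ*size]≤Pr[u]*[ExpSize+1])) ⟩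
    (c + c) * p - c * c * 𝔼 D (λ S → ind (memEvent u S) * size S)
      ≡⟨ 𝔼-linear (c + c) (c * c) (λ S → ind (memEvent u S)) (λ S → ind (memEvent u S) * size S) ⟨
    𝔼 D (λ S → (c + c) * ind (memEvent u S) - c * c * (ind (memEvent u S) * size S))
      ≡⟨ 𝔼-cong (λ S → collect (ind (memEvent u S)) c (size S)) ⟩
    𝔼 D (λ S → ind (memEvent u S) * tangent c (size S))
      ≤⟨ 𝔼-mono (λ S → ind*tangent≤ind*inv c (memEvent u S) ∣ S ∣ (∈⇒∣S∣≢0 S u)) ⟩
    PrEqUniform D u
      ∎
    where
    open ≤-Reasoning
    b c : ℚ
    b = ExpSize D + 1ℚ
    c = 1/ b
    expand : ∀ p c b → p * tangent c b ≡ (c + c) * p - c * c * (p * b)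
    expand = solve 3 (λ p c b → p :* (c :+ c :- c :* c :* b)
                              := (c :+ c) :* p :- c :* c :* (p :* b)) refl
    collect : ∀ i c s → (c + c) * i - c * c * (i * s) ≡ i * tangent c s
    collect = solve 3 (λ i c s → (c :+ c) :* i :- c :* c :* (i :* s)
                               := i :* (c :+ c :- c :* c :* s)) refl

mainTheorem9 : (n : ℕ) (D : Distribution n) (u : Fin n) →
    JointlyIndepOf D u →
    (Pr D (memEvent u) ÷' (ExpSize D + 1ℚ)) ≤ PrEqUniform D u
mainTheorem9 zero    D ()
mainTheorem9 (suc n) D u indep with ExpSize D + 1ℚ ≟ 0ℚ
... | no  b≢0 = Pr[u]*1/[ExpSize+1]≤PrEqUniform D u indep {{≢-nonZero b≢0}}
-- Unreachable since ExpSize D ≥ 0, but the junk quotient 0 is a lower bound anyway.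
... | yes _    = Expectation.𝔼-nonNeg D (λ S → 0≤* (0≤ind (memEvent u S)) (0≤inv ∣ S ∣))
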